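{- There are $2^{\aleph_0}$ pairwise non-isomorphic countable homogeneous groups.
   Context: A countable group $G$ is homogeneous if every isomorphism between finitely generated subgroups of $G$ extends to an automorphism of $G$. -}

module Defs where

open import Level using (0ℓ)
open import Algebra.Bundles using (Group)
open import Data.Nat using (ℕ)
open import Data.Bool using (Bool)
open import Data.Fin using (Fin)
open import Data.Product using (Σ; ∃; _×_; _,_; proj₁)
open import Relation.Binary.PropositionalEquality using (_≡_)
open import Relation.Nullary using (¬_)

data Word (n : ℕ) : Set where
  gen  : Fin n → Word n
  unit : Word n
  _·_  : Word n → Word n → Word n
  inv  : Word n → Word n

module _ (G : Group 0ℓ 0ℓ) where
  open Group G

  eval : ∀ {n} → (Fin n → Carrier) → Word n → Carrier
  eval a (gen i) = a i
  eval a unit    = ε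
  eval a (u · v) = eval a u ∙ eval a v
  eval a (inv u) = eval a u ⁻¹

  _∈⟨_⟩ : ∀ {n} → Carrier → (Fin n → Carrier) → Set
  x ∈⟨ a ⟩ = ∃ λ w → eval a w ≈ x

  ⟨_⟩ : ∀ {n} → (Fin n → Carrier) → Set
  ⟨ a ⟩ = Σ Carrier (λ x → x ∈⟨ a ⟩)

  record SubIso {m n} (a : Fin m → Carrier) (b : Fin n → Carrier) : Set where
    field
      φ     : ⟨ a ⟩ → ⟨ b ⟩
      cong  : ∀ x y → proj₁ x ≈ proj₁ y → proj₁ (φ x) ≈ proj₁ (φ y)
      hom   : ∀ x y (xy : ⟨ a ⟩) → proj₁ xy ≈ proj₁ x ∙ proj₁ y →
              proj₁ (φ xy) ≈ proj₁ (φ x) ∙ proj₁ (φ y)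
      inj   : ∀ x y → proj₁ (φ x) ≈ proj₁ (φ y) → proj₁ x ≈ proj₁ y
      surj  : ∀ (y : ⟨ b ⟩) → ∃ λ (x : ⟨ a ⟩) → proj₁ (φ x) ≈ proj₁ y

  record Automorphism : Set where
    field
      α     : Carrier → Carrier
      cong  : ∀ x y → x ≈ y → α x ≈ α y
      hom   : ∀ x y → α (x ∙ y) ≈ α x ∙ α y
      inj   : ∀ x y → α x ≈ α y → x ≈ y
      surj  : ∀ y → ∃ λ x → α x ≈ y

  -- G is countable: some map ℕ → G is onto (groups are nonempty)
  Countable : Set
  Countable = Σ (ℕ → Carrier) λ f → ∀ x → ∃ λ k → f k ≈ x

  Homogeneous : Set
  Homogeneous = ∀ {m n} (a : Fin m → Carrier) (b : Fin n → Carrier) →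
    (ψ : SubIso a b) →
    Σ Automorphism λ A →
      ∀ (x : ⟨ a ⟩) → Automorphism.α A (proj₁ x) ≈ proj₁ (SubIso.φ ψ x)

record _≅_ (G H : Group 0ℓ 0ℓ) : Set where
  module G = Group G
  module H = Group H
  field
    f     : G.Carrier → H.Carrier
    cong  : ∀ x y → x G.≈ y → f x H.≈ f y
    hom   : ∀ x y → f (x G.∙ y) H.≈ f x H.∙ f y
    inj   : ∀ x y → f x H.≈ f y → x G.≈ y
    surj  : ∀ y → ∃ λ x → f x H.≈ y

module Submission where

-- Let euclid 0, euclid 1, … be distinct primes (Euclid's construction: euclid k
-- divides 1 + the product of the earlier ones).  For s : ℕ → Bool let Gₛ be the
-- direct sum ⊕ₖ ℤ/mₖ with mₖ = euclid k if s k and mₖ = 1 otherwise, realised as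
-- finitely supported integer sequences compared coordinatewise modulo mₖ.
--
--  * Countable: by the Chinese remainder theorem every element equals a constant
--    sequence (z, …, z, 0, …), and these are enumerated by ℕ × ℤ.
--  * Homogeneous: for x supported below L there is an integer E (again from the
--    Chinese remainder theorem) with x ^ E = e k ^ xₖ, the projection onto the k-th
--    summand.  An isomorphism ψ : ⟨a⟩ → ⟨b⟩ commutes with powers, hence acts on
--    the k-th summand as multiplication by a unit cₖ modulo mₖ; rescaling every
--    coordinate k by cₖ is an automorphism of Gₛ extending ψ.
--  * Non-isomorphic: Gₛ has an element x ≠ ε with x ^ euclid k = ε iff s k, and
--    such torsion is preserved by isomorphisms.

open import Defs
open import Level using (0ℓ)
open import Algebra.Bundles using (Group)
open import Data.Nat using (ℕ)
open import Data.Bool using (Bool)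
open import Data.Product using (Σ; _×_)
open import Relation.Binary.PropositionalEquality using (_≡_)
open import Relation.Nullary using (¬_)

open import Algebra.Bundles using (RawGroup)
open import Algebra.Morphism.Structures using (module MagmaMorphisms; module GroupMorphisms)
import Algebra.Morphism.GroupMonomorphism as GroupMonomorphism
import Algebra.Properties.Group as GroupP
open import Data.Bool using (true; false; if_then_else_)
open import Data.Bool.Properties using (⇔→≡)
open import Data.Empty using (⊥-elim)
open import Data.Fin as Fin using (Fin)
open import Data.Fin.Properties using (all?; ¬∀⟶∃¬)
open import Data.Integer using (ℤ; +_; -[1+_]; _+_; _*_; -_; _-_; 0ℤ; 1ℤ; -1ℤ)
import Data.Integer.Properties as ℤP
open import Data.Integer.Divisibility.Signed
  using (_∣_; _∣?_; divides; ∣-trans; ∣m∣n⇒∣m+n; ∣m⇒∣-m; ∣n⇒∣m*n; ∣⇒∣ᵤ; ∣ᵤ⇒∣)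
open import Data.Integer.Tactic.RingSolver using (solve-∀)
open import Data.List using (List; []; _∷_)
open import Data.List.Relation.Unary.All using (All; []; _∷_)
open import Data.Nat as ℕ using (zero; suc; _≤_; _<_; _⊔_; _<?_; z≤n; s≤s)
open import Data.Nat.Coprimality using (coprime-Bézout)
open import Data.Nat.Divisibility as ℕ∣ using () renaming (_∣_ to _∣ℕ_)
open import Data.Nat.GCD using (module Bézout)
open import Data.Nat.ListAction using (product)
open import Data.Nat.Primality using (Prime; prime⇒irreducible; prime⇒nonZero; ¬prime[1]; prime[2])
open import Data.Nat.Primality.Factorisation using (factorise; factors; PrimeFactorisation)
import Data.Nat.Properties as ℕP
open import Data.Product using (∃; _,_; proj₁; proj₂)
open import Data.Sum using (_⊎_; inj₁; inj₂)
open import Function.Base using (_∘_)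
open import Function.Bundles using (_⇔_; mk⇔; Equivalence)
open import Relation.Binary.Bundles using (Setoid)
open import Relation.Binary.Definitions using (tri<; tri≈; tri>)
open import Relation.Binary.PropositionalEquality
  using (_≢_; refl; sym; trans; cong; cong₂; subst; module ≡-Reasoning)
import Relation.Binary.Reasoning.Setoid
open import Relation.Nullary using (yes; no)
open import Relation.Nullary.Decidable using (toSum)

infix 4 _≡_mod_
record _≡_mod_ (a b : ℤ) (m : ℕ) : Set where
  constructor mk≡mod
  field divides-difference : + m ∣ a - b

module _ {m : ℕ} where

  mod-reflexive : ∀ {a b} → a ≡ b → a ≡ b mod m
  mod-reflexive {a} refl = mk≡mod (divides 0ℤ (ℤP.+-inverseʳ a))

  mod-refl : ∀ {a} → a ≡ a mod m
  mod-refl = mod-reflexive refl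

  mod-sym : ∀ {a b} → a ≡ b mod m → b ≡ a mod m
  mod-sym {a} {b} (mk≡mod m∣a-b) = mk≡mod (subst (+ m ∣_) (lemma a b) (∣m⇒∣-m m∣a-b))
    where lemma : ∀ a b → - (a - b) ≡ b - a
          lemma = solve-∀

  mod-trans : ∀ {a b c} → a ≡ b mod m → b ≡ c mod m → a ≡ c mod m
  mod-trans {a} {b} {c} (mk≡mod m∣a-b) (mk≡mod m∣b-c) =
    mk≡mod (subst (+ m ∣_) (lemma a b c) (∣m∣n⇒∣m+n m∣a-b m∣b-c))
    where lemma : ∀ a b c → (a - b) + (b - c) ≡ a - c
          lemma = solve-∀

mod-one : ∀ {a b} → a ≡ b mod 1
mod-one {a} {b} = mk≡mod (divides (a - b) (sym (ℤP.*-identityʳ (a - b))))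

mod-setoid : ℕ → Setoid 0ℓ 0ℓ
mod-setoid m = record
  { Carrier = ℤ
  ; _≈_ = λ a b → a ≡ b mod m
  ; isEquivalence = record { refl = mod-refl ; sym = mod-sym ; trans = mod-trans }
  }

module ≡-mod-Reasoning (m : ℕ) where
  open import Relation.Binary.Reasoning.Setoid (mod-setoid m) public

module _ {m : ℕ} where

  mod-+ : ∀ {a b c d} → a ≡ b mod m → c ≡ d mod m → a + c ≡ b + d mod m
  mod-+ {a} {b} {c} {d} (mk≡mod m∣a-b) (mk≡mod m∣c-d) =
    mk≡mod (subst (+ m ∣_) (lemma a b c d) (∣m∣n⇒∣m+n m∣a-b m∣c-d))
    where lemma : ∀ a b c d → (a - b) + (c - d) ≡ (a + c) - (b + d)
          lemma = solve-∀

  mod-+ˡ : ∀ c {a b} → a ≡ b mod m → c + a ≡ c + b mod m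
  mod-+ˡ c = mod-+ (mod-refl {a = c})

  mod-neg : ∀ {a b} → a ≡ b mod m → - a ≡ - b mod m
  mod-neg {a} {b} (mk≡mod m∣a-b) = mk≡mod (subst (+ m ∣_) (lemma a b) (∣m⇒∣-m m∣a-b))
    where lemma : ∀ a b → - (a - b) ≡ (- a) - (- b)
          lemma = solve-∀

  mod-* : ∀ {a b c d} → a ≡ b mod m → c ≡ d mod m → a * c ≡ b * d mod m
  mod-* {a} {b} {c} {d} (mk≡mod m∣a-b) (mk≡mod m∣c-d) =
    mk≡mod (subst (+ m ∣_) (lemma a b c d) (∣m∣n⇒∣m+n (∣n⇒∣m*n c m∣a-b) (∣n⇒∣m*n b m∣c-d)))
    where lemma : ∀ a b c d → c * (a - b) + b * (c - d) ≡ a * c - b * d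
          lemma = solve-∀

  mod-*ˡ : ∀ c {a b} → a ≡ b mod m → c * a ≡ c * b mod m
  mod-*ˡ c = mod-* (mod-refl {a = c})

  ∣⇒≡0 : ∀ {a} → + m ∣ a → a ≡ 0ℤ mod m
  ∣⇒≡0 {a} m∣a = mk≡mod (subst (+ m ∣_) (sym (ℤP.+-identityʳ a)) m∣a)

  ≡0⇒∣ : ∀ {a} → a ≡ 0ℤ mod m → + m ∣ a
  ≡0⇒∣ {a} (mk≡mod m∣a-0) = subst (+ m ∣_) (ℤP.+-identityʳ a) m∣a-0

  mod-weaken : ∀ {n a b} → m ∣ℕ n → a ≡ b mod n → a ≡ b mod m
  mod-weaken m∣n (mk≡mod n∣a-b) = mk≡mod (∣-trans (∣ᵤ⇒∣ m∣n) n∣a-b)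

  mod-cancel : ∀ {c d a b} → c * d ≡ 1ℤ mod m → c * a ≡ c * b mod m → a ≡ b mod m
  mod-cancel {c} {d} {a} {b} cd≡1 ca≡cb = begin
    a             ≡⟨ ℤP.*-identityˡ a ⟨
    1ℤ * a        ≈⟨ mod-* (mod-sym cd≡1) mod-refl ⟩
    (c * d) * a   ≡⟨ reassociate c d a ⟩
    d * (c * a)   ≈⟨ mod-*ˡ d ca≡cb ⟩
    d * (c * b)   ≡⟨ reassociate c d b ⟨
    (c * d) * b   ≈⟨ mod-* cd≡1 mod-refl ⟩
    1ℤ * b        ≡⟨ ℤP.*-identityˡ b ⟩
    b             ∎
    where
    open ≡-mod-Reasoning m
    reassociate : ∀ c d a → (c * d) * a ≡ d * (c * a)
    reassociate = solve-∀

module _ {q : ℕ} (q-prime : Prime q) where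

  private
    coprime : ∀ {n} → ¬ (q ∣ℕ n) → ∀ {d} → d ∣ℕ q × d ∣ℕ n → d ≡ 1
    coprime q∤n (d∣q , d∣n) with prime⇒irreducible q-prime d∣q
    ... | inj₁ d≡1 = d≡1
    ... | inj₂ refl = ⊥-elim (q∤n d∣n)

    embed : ∀ a b c d → 1 ℕ.+ a ℕ.* b ≡ c ℕ.* d → 1ℤ + + a * + b ≡ + c * + d
    embed a b c d eq = begin
      1ℤ + + a * + b     ≡⟨ cong (λ v → 1ℤ + v) (ℤP.pos-* a b) ⟨
      + (1 ℕ.+ a ℕ.* b)  ≡⟨ cong +_ eq ⟩
      + (c ℕ.* d)        ≡⟨ ℤP.pos-* c d ⟩
      + c * + d          ∎
      where open ≡-Reasoning

    natural-inverse : ∀ n → ¬ (q ∣ℕ n) → ∃ λ u → u * + n ≡ 1ℤ mod q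
    natural-inverse n q∤n with coprime-Bézout (coprime q∤n)
    ... | Bézout.+- x y 1+yn≡xq = - + y , mk≡mod (divides (- + x) (begin
      (- + y) * + n - 1ℤ   ≡⟨ lemma (+ y) (+ n) ⟩
      - (1ℤ + + y * + n)   ≡⟨ cong -_ (embed y n x q 1+yn≡xq) ⟩
      - (+ x * + q)        ≡⟨ ℤP.neg-distribˡ-* (+ x) (+ q) ⟩
      (- + x) * + q        ∎))
      where
      open ≡-Reasoning
      lemma : ∀ y n → (- y) * n - 1ℤ ≡ - (1ℤ + y * n)
      lemma = solve-∀
    ... | Bézout.-+ x y 1+xq≡yn = + y , mk≡mod (divides (+ x) (begin
      + y * + n - 1ℤ       ≡⟨ cong (_- 1ℤ) (embed x q y n 1+xq≡yn) ⟨
      1ℤ + + x * + q - 1ℤ  ≡⟨ lemma (+ x * + q) ⟩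
      + x * + q            ∎))
      where
      open ≡-Reasoning
      lemma : ∀ a → 1ℤ + a - 1ℤ ≡ a
      lemma = solve-∀

  inverse-mod-prime : ∀ z → ¬ (+ q ∣ z) → ∃ λ u → u * z ≡ 1ℤ mod q
  inverse-mod-prime (+ n) q∤n = natural-inverse n (λ q∣n → q∤n (∣ᵤ⇒∣ q∣n))
  inverse-mod-prime -[1+ n ] q∤z
    with natural-inverse (suc n) (λ q∣n → q∤z (∣m⇒∣-m (∣ᵤ⇒∣ q∣n)))
  ... | u , u·n≡1 = - u , mod-trans (mod-reflexive (lemma u (+ suc n))) u·n≡1
    where lemma : ∀ u n → (- u) * (- n) ≡ u * n
          lemma = solve-∀

firstOr2 : List ℕ → ℕ
firstOr2 []      = 2
firstOr2 (q ∷ _) = q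

-- A prime divisor of n + 1 for n ≥ 1, read off the prime factorisation of n + 1
-- (for n = 0 the value is the prime 2).
primeDivisor : ℕ → ℕ
primeDivisor n = firstOr2 (factors (factorise (suc n)))

primeDivisor-prime : ∀ n → Prime (primeDivisor n)
primeDivisor-prime n = first-prime (PrimeFactorisation.factorsPrime (factorise (suc n)))
  where
  first-prime : ∀ {qs} → All Prime qs → Prime (firstOr2 qs)
  first-prime []            = prime[2]
  first-prime (q-prime ∷ _) = q-prime

primeDivisor-∣ : ∀ n → 1 ≤ n → primeDivisor n ∣ℕ suc n
primeDivisor-∣ (suc n) _ =
  first-∣ (factors (factorise (suc (suc n)))) (PrimeFactorisation.isFactorisation (factorise (suc (suc n))))
  where
  first-∣ : ∀ qs → suc (suc n) ≡ product qs → firstOr2 qs ∣ℕ suc (suc n)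
  first-∣ (q ∷ qs) 2+n≡q·qs = subst (q ∣ℕ_) (sym 2+n≡q·qs) (ℕ∣.m∣m*n (product qs))

-- Euclid's sequence of primes: the k-th prime divides one more than the
-- product (the primorial) of all earlier ones, so all of them are distinct.
primorial : ℕ → ℕ
euclid    : ℕ → ℕ
primorial zero    = 1
primorial (suc k) = primorial k ℕ.* euclid k
euclid k = primeDivisor (primorial k)

euclid-prime : ∀ k → Prime (euclid k)
euclid-prime k = primeDivisor-prime (primorial k)

primorial-positive : ∀ k → 1 ≤ primorial k
primorial-positive zero    = s≤s z≤n
primorial-positive (suc k) =
  ℕP.*-mono-≤ (primorial-positive k) (ℕ.>-nonZero⁻¹ (euclid k) {{prime⇒nonZero (euclid-prime k)}})

euclid-∣-primorial+1 : ∀ k → euclid k ∣ℕ suc (primorial k)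
euclid-∣-primorial+1 k = primeDivisor-∣ (primorial k) (primorial-positive k)

euclid-∣-primorial : ∀ {j k} → j < k → euclid j ∣ℕ primorial k
euclid-∣-primorial {j} {suc k} (s≤s j≤k) with ℕP.m≤n⇒m<n∨m≡n j≤k
... | inj₁ j<k  = ℕ∣.∣m⇒∣m*n (euclid k) (euclid-∣-primorial j<k)
... | inj₂ refl = ℕ∣.n∣m*n (primorial j)

euclid-∤-primorial : ∀ k → ¬ (euclid k ∣ℕ primorial k)
euclid-∤-primorial k e∣prim = ¬prime[1] (subst Prime e≡1 (euclid-prime k))
  where
  e∣prim+1 : euclid k ∣ℕ primorial k ℕ.+ 1
  e∣prim+1 = subst (euclid k ∣ℕ_) (ℕP.+-comm 1 (primorial k)) (euclid-∣-primorial+1 k)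
  e≡1 : euclid k ≡ 1
  e≡1 = ℕ∣.∣1⇒≡1 (ℕ∣.∣m+n∣m⇒∣n e∣prim+1 e∣prim)

euclid-injective : ∀ {j k} → j ≢ k → euclid j ≢ euclid k
euclid-injective {j} {k} j≢k e with ℕP.<-cmp j k
... | tri< j<k _ _ = euclid-∤-primorial k (subst (_∣ℕ primorial k) e (euclid-∣-primorial j<k))
... | tri≈ _ j≡k _ = j≢k j≡k
... | tri> _ _ k<j = euclid-∤-primorial j (subst (_∣ℕ primorial j) (sym e) (euclid-∣-primorial k<j))

euclid-∤-euclid : ∀ {j k} → j ≢ k → ¬ (euclid j ∣ℕ euclid k)
euclid-∤-euclid {j} {k} j≢k ej∣ek with prime⇒irreducible (euclid-prime k) ej∣ek
... | inj₁ ej≡1  = ¬prime[1] (subst Prime ej≡1 (euclid-prime j))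
... | inj₂ ej≡ek = euclid-injective j≢k ej≡ek

primorial≡-1 : ∀ k → + primorial k ≡ -1ℤ mod euclid k
primorial≡-1 k = mk≡mod (subst (+ euclid k ∣_) (lemma (primorial k)) (∣ᵤ⇒∣ (euclid-∣-primorial+1 k)))
  where lemma : ∀ n → + suc n ≡ + n - -1ℤ
        lemma n = cong +_ (ℕP.+-comm 1 n)

-- Moduli m j dividing the Euclid primes: each m j is 1 or euclid j, so they
-- are pairwise coprime and every nonzero residue modulo m j is invertible.
module _ {m : ℕ → ℕ} (m∣euclid : ∀ j → m j ∣ℕ euclid j) where

  -- The inductive step corrects the previous
  -- solution by a multiple of primorial n, which is −1 modulo euclid n.
  chinese-remainder : (g : ℕ → ℤ) → ∀ n → ∃ λ z → ∀ j → j < n → z ≡ g j mod m j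
  chinese-remainder g zero    = 0ℤ , λ _ ()
  chinese-remainder g (suc n) with chinese-remainder g n
  ... | z , z≡g = z + (z - g n) * + primorial n , solves
    where
    solves : ∀ j → j < suc n → z + (z - g n) * + primorial n ≡ g j mod m j
    solves j (s≤s j≤n) with ℕP.m≤n⇒m<n∨m≡n j≤n
    ... | inj₁ j<n = begin
      z + (z - g n) * + primorial n  ≈⟨ mod-+ˡ z (∣⇒≡0 (∣n⇒∣m*n (z - g n) m∣primorial)) ⟩
      z + 0ℤ                         ≡⟨ ℤP.+-identityʳ z ⟩
      z                              ≈⟨ z≡g j j<n ⟩
      g j                            ∎
      where
      open ≡-mod-Reasoning (m j)
      m∣primorial : + m j ∣ + primorial n
      m∣primorial = ∣ᵤ⇒∣ (ℕ∣.∣-trans (m∣euclid j) (euclid-∣-primorial j<n))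
    ... | inj₂ refl = mod-weaken (m∣euclid n) (begin
      z + (z - g n) * + primorial n  ≈⟨ mod-+ˡ z (mod-*ˡ (z - g n) (primorial≡-1 n)) ⟩
      z + (z - g n) * -1ℤ            ≡⟨ lemma z (g n) ⟩
      g n                            ∎)
      where
      open ≡-mod-Reasoning (euclid n)
      lemma : ∀ z g → z + (z - g) * -1ℤ ≡ g
      lemma = solve-∀

  modulus-cases : ∀ j → m j ≡ 1 ⊎ m j ≡ euclid j
  modulus-cases j = prime⇒irreducible (euclid-prime j) (m∣euclid j)

  inverse-mod : ∀ j z → ¬ (+ m j ∣ z) → ∃ λ u → u * z ≡ 1ℤ mod m j
  inverse-mod j z m∤z with modulus-cases j
  ... | inj₁ mj≡1 rewrite mj≡1 = ⊥-elim (m∤z (divides z (sym (ℤP.*-identityʳ z))))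
  ... | inj₂ mj≡e rewrite mj≡e = inverse-mod-prime (euclid-prime j) z m∤z

  euclid-cancel : ∀ {j k a} → j ≢ k → + euclid k * a ≡ 0ℤ mod m j → a ≡ 0ℤ mod m j
  euclid-cancel {j} {k} {a} j≢k pa≡0 with modulus-cases j
  ... | inj₁ mj≡1 rewrite mj≡1 = mod-one
  ... | inj₂ mj≡e rewrite mj≡e with inverse-mod-prime (euclid-prime j) (+ euclid k) (euclid-∤-euclid j≢k ∘ ∣⇒∣ᵤ)
  ... | u , up≡1 =
    mod-cancel {c = + euclid k} {d = u} pu≡1 (mod-trans pa≡0 (mod-reflexive (sym (ℤP.*-zeroʳ (+ euclid k)))))
    where pu≡1 : + euclid k * u ≡ 1ℤ mod euclid j
          pu≡1 = mod-trans (mod-reflexive (ℤP.*-comm (+ euclid k) u)) up≡1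

module Powers (G : Group 0ℓ 0ℓ) where
  open Group G

  infixr 8 _^⁺_ _^_
  _^⁺_ : Carrier → ℕ → Carrier
  x ^⁺ zero  = ε
  x ^⁺ suc n = x ∙ x ^⁺ n

  _^_ : Carrier → ℤ → Carrier
  x ^ + n      = x ^⁺ n
  x ^ -[1+ n ] = (x ^⁺ suc n) ⁻¹

  ^⁺-cong : ∀ {x y} → x ≈ y → ∀ n → x ^⁺ n ≈ y ^⁺ n
  ^⁺-cong x≈y zero    = Group.refl G
  ^⁺-cong x≈y (suc n) = ∙-cong x≈y (^⁺-cong x≈y n)

  ^-cong : ∀ {x y} → x ≈ y → ∀ z → x ^ z ≈ y ^ z
  ^-cong x≈y (+ n)      = ^⁺-cong x≈y n
  ^-cong x≈y -[1+ n ] = ⁻¹-cong (^⁺-cong x≈y (suc n))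

  HasTorsion : ℕ → Set
  HasTorsion n = ∃ λ x → ¬ (x ≈ ε) × x ^ + n ≈ ε

IsHom : (G H : Group 0ℓ 0ℓ) → (Group.Carrier G → Group.Carrier H) → Set
IsHom G H = MagmaMorphisms.IsMagmaHomomorphism (Group.rawMagma G) (Group.rawMagma H)

module HomProperties {G H : Group 0ℓ 0ℓ} {f : Group.Carrier G → Group.Carrier H}
                     (f-hom : IsHom G H f) where
  private
    module G = Group G
    module H = Group H
    open Powers
  open MagmaMorphisms.IsMagmaHomomorphism f-hom using (⟦⟧-cong; homo)
  open Relation.Binary.Reasoning.Setoid H.setoid

  ε-homo : f G.ε H.≈ H.ε
  ε-homo = GroupP.identityˡ-unique H (f G.ε) (f G.ε) (begin
    f G.ε H.∙ f G.ε   ≈⟨ homo G.ε G.ε ⟨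
    f (G.ε G.∙ G.ε)   ≈⟨ ⟦⟧-cong (G.identityˡ G.ε) ⟩
    f G.ε             ∎)

  ⁻¹-homo : ∀ x → f (x G.⁻¹) H.≈ f x H.⁻¹
  ⁻¹-homo x = GroupP.inverseˡ-unique H (f (x G.⁻¹)) (f x) (begin
    f (x G.⁻¹) H.∙ f x  ≈⟨ homo (x G.⁻¹) x ⟨
    f (x G.⁻¹ G.∙ x)    ≈⟨ ⟦⟧-cong (G.inverseˡ x) ⟩
    f G.ε               ≈⟨ ε-homo ⟩
    H.ε                 ∎)

  ^⁺-homo : ∀ x n → f (_^⁺_ G x n) H.≈ _^⁺_ H (f x) n
  ^⁺-homo x zero    = ε-homo
  ^⁺-homo x (suc n) = begin
    f (x G.∙ _^⁺_ G x n)           ≈⟨ homo x (_^⁺_ G x n) ⟩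
    f x H.∙ f (_^⁺_ G x n)         ≈⟨ H.∙-congˡ (^⁺-homo x n) ⟩
    f x H.∙ _^⁺_ H (f x) n         ∎

  ^-homo : ∀ x z → f (_^_ G x z) H.≈ _^_ H (f x) z
  ^-homo x (+ n)      = ^⁺-homo x n
  ^-homo x -[1+ n ] = H.trans (⁻¹-homo (_^⁺_ G x (suc n))) (H.⁻¹-cong (^⁺-homo x (suc n)))

  injective-reflects-ε : (∀ x y → f x H.≈ f y → x G.≈ y) → ∀ x → f x H.≈ H.ε → x G.≈ G.ε
  injective-reflects-ε inj x fx≈ε = inj x G.ε (H.trans fx≈ε (H.sym ε-homo))

module _ {G H : Group 0ℓ 0ℓ} (I : G ≅ H) where
  private
    module G = Group G
    module H = Group H
    open _≅_ I using (f; inj; surj)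
    open Powers

  ≅-isHom : IsHom G H f
  ≅-isHom = record
    { isRelHomomorphism = record { cong = λ {x} {y} → _≅_.cong I x y }
    ; homo = _≅_.hom I
    }

  open HomProperties {G} {H} ≅-isHom

  ≅-preserves-torsion : ∀ n → HasTorsion G n → HasTorsion H n
  ≅-preserves-torsion n (x , x≉ε , xⁿ≈ε) = f x , fx≉ε , fxⁿ≈ε
    where
    fx≉ε : ¬ (f x H.≈ H.ε)
    fx≉ε fx≈ε = x≉ε (injective-reflects-ε inj x fx≈ε)
    fxⁿ≈ε : _^_ H (f x) (+ n) H.≈ H.ε
    fxⁿ≈ε = H.trans (H.sym (^-homo x (+ n))) (H.trans (_≅_.cong I _ _ xⁿ≈ε) ε-homo)

  ≅-reflects-torsion : ∀ n → HasTorsion H n → HasTorsion G n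
  ≅-reflects-torsion n (y , y≉ε , yⁿ≈ε) with surj y
  ... | x , fx≈y = x , x≉ε , xⁿ≈ε
    where
    x≉ε : ¬ (x G.≈ G.ε)
    x≉ε x≈ε = y≉ε (H.trans (H.sym fx≈y) (H.trans (_≅_.cong I _ _ x≈ε) ε-homo))
    xⁿ≈ε : _^_ G x (+ n) G.≈ G.ε
    xⁿ≈ε = injective-reflects-ε inj (_^_ G x (+ n))
             (H.trans (^-homo x (+ n)) (H.trans (^-cong H fx≈y (+ n)) yⁿ≈ε))

module Generated (G : Group 0ℓ 0ℓ) {n : ℕ} (a : Fin n → Group.Carrier G) where
  open Group G renaming (refl to ≈-refl)

  private
    _∙ₐ_ : ⟨_⟩ G a → ⟨_⟩ G a → ⟨_⟩ G a
    (x , u , u↦x) ∙ₐ (y , v , v↦y) = x ∙ y , u · v , ∙-cong u↦x v↦y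

    _⁻¹ₐ : ⟨_⟩ G a → ⟨_⟩ G a
    (x , u , u↦x) ⁻¹ₐ = x ⁻¹ , inv u , ⁻¹-cong u↦x

    raw : RawGroup 0ℓ 0ℓ
    raw = record
      { Carrier = ⟨_⟩ G a
      ; _≈_ = λ x y → proj₁ x ≈ proj₁ y
      ; _∙_ = _∙ₐ_
      ; ε = ε , unit , ≈-refl
      ; _⁻¹ = _⁻¹ₐ
      }

    inclusion-isMonomorphism : GroupMorphisms.IsGroupMonomorphism raw rawGroup proj₁
    inclusion-isMonomorphism = record
      { isGroupHomomorphism = record
        { isMonoidHomomorphism = record
          { isMagmaHomomorphism = record
            { isRelHomomorphism = record { cong = λ x≈y → x≈y }
            ; homo = λ _ _ → ≈-refl
            }
          ; ε-homo = ≈-refl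
          }
        ; ⁻¹-homo = λ _ → ≈-refl
        }
      ; injective = λ x≈y → x≈y
      }

  generated : Group 0ℓ 0ℓ
  generated = record
    { RawGroup raw
    ; isGroup = GroupMonomorphism.isGroup inclusion-isMonomorphism isGroup
    }

  inclusion-isHom : IsHom generated G proj₁
  inclusion-isHom = GroupMorphisms.IsGroupMonomorphism.isMagmaHomomorphism inclusion-isMonomorphism

  subIso-isHom : ∀ {k} {b : Fin k → Carrier} (ψ : SubIso G a b) →
                 IsHom generated G (λ x → proj₁ (SubIso.φ ψ x))
  subIso-isHom ψ = record
    { isRelHomomorphism = record { cong = λ {x} {y} → SubIso.cong ψ x y }
    ; homo = λ x y → SubIso.hom ψ x y (Group._∙_ generated x y) ≈-refl
    }

-- An enumeration of ℕ × ℤ.  The pairs of naturals are listed along the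
-- anti-diagonals (Cantor), and a pair (a , b) encodes the integer a − b.
nextPair : ℕ × ℕ → ℕ × ℕ
nextPair (zero  , b) = suc b , 0
nextPair (suc a , b) = a , suc b

pairs : ℕ → ℕ × ℕ
pairs zero    = 0 , 0
pairs (suc N) = nextPair (pairs N)

pairs-walk : ∀ b a c N → pairs N ≡ (b ℕ.+ a , c) → pairs (b ℕ.+ N) ≡ (a , b ℕ.+ c)
pairs-walk zero    a c N eq = eq
pairs-walk (suc b) a c N eq =
  cong nextPair (pairs-walk b (suc a) c N (trans eq (cong (_, c) (sym (ℕP.+-suc b a)))))

pairs-diagonal : ∀ d → ∃ λ N → pairs N ≡ (d , 0)
pairs-diagonal zero    = 0 , refl
pairs-diagonal (suc d) with pairs-diagonal d
... | N , eq = suc (d ℕ.+ N) , cong nextPair (begin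
  pairs (d ℕ.+ N)  ≡⟨ pairs-walk d 0 0 N (trans eq (cong (_, 0) (sym (ℕP.+-identityʳ d)))) ⟩
  (0 , d ℕ.+ 0)    ≡⟨ cong (0 ,_) (ℕP.+-identityʳ d) ⟩
  (0 , d)          ∎)
  where open ≡-Reasoning

pairs-surjective : ∀ a b → ∃ λ N → pairs N ≡ (a , b)
pairs-surjective a b with pairs-diagonal (b ℕ.+ a)
... | N , eq = b ℕ.+ N , trans (pairs-walk b a 0 N eq) (cong (a ,_) (ℕP.+-identityʳ b))

difference : ℕ × ℕ → ℤ
difference (a , b) = + a - + b

difference-surjective : ∀ z → ∃ λ ab → difference ab ≡ z
difference-surjective (+ a)      = (a , 0) , ℤP.+-identityʳ (+ a)
difference-surjective -[1+ b ] = (0 , suc b) , ℤP.+-identityˡ -[1+ b ]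

enumerate : ℕ → ℕ × ℤ
enumerate N = proj₁ (pairs N) , difference (pairs (proj₂ (pairs N)))

enumerate-surjective : ∀ n z → ∃ λ N → enumerate N ≡ (n , z)
enumerate-surjective n z with difference-surjective z
... | (a , b) , a-b≡z with pairs-surjective a b
...   | r , pairs-r≡ab with pairs-surjective n r
...     | N , pairs-N≡nr = N , cong₂ _,_ (cong proj₁ pairs-N≡nr) (begin
  difference (pairs (proj₂ (pairs N)))  ≡⟨ cong (λ p → difference (pairs (proj₂ p))) pairs-N≡nr ⟩
  difference (pairs r)                  ≡⟨ cong difference pairs-r≡ab ⟩
  difference (a , b)                    ≡⟨ a-b≡z ⟩
  z                                     ∎)
  where open ≡-Reasoning

record FinSeq : Set where
  constructor finSeq
  field
    bound    : ℕ
    coeff    : ℕ → ℤ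
    vanishes : ∀ j → bound ≤ j → coeff j ≡ 0ℤ
open FinSeq public

zeroSeq : FinSeq
zeroSeq = finSeq 0 (λ _ → 0ℤ) (λ _ _ → refl)

infixl 6 _⊕_
_⊕_ : FinSeq → FinSeq → FinSeq
x ⊕ y = finSeq (bound x ⊔ bound y) (λ j → coeff x j + coeff y j) vanish
  where
  vanish : ∀ j → bound x ⊔ bound y ≤ j → coeff x j + coeff y j ≡ 0ℤ
  vanish j le = cong₂ _+_ (vanishes x j (ℕP.≤-trans (ℕP.m≤m⊔n (bound x) (bound y)) le))
                          (vanishes y j (ℕP.≤-trans (ℕP.m≤n⊔m (bound x) (bound y)) le))

⊖_ : FinSeq → FinSeq
⊖ x = finSeq (bound x) (λ j → - coeff x j) (λ j le → cong -_ (vanishes x j le))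

δ : ℕ → ℕ → ℤ
δ k j with j ℕ.≟ k
... | yes _ = 1ℤ
... | no  _ = 0ℤ

δ-diagonal : ∀ k → δ k k ≡ 1ℤ
δ-diagonal k with k ℕ.≟ k
... | yes _   = refl
... | no  k≢k = ⊥-elim (k≢k refl)

δ-off-diagonal : ∀ {k j} → j ≢ k → δ k j ≡ 0ℤ
δ-off-diagonal {k} {j} j≢k with j ℕ.≟ k
... | yes j≡k = ⊥-elim (j≢k j≡k)
... | no  _   = refl

δ-swap : ∀ k j (c : ℕ → ℤ) → δ k j * c j ≡ c k * δ k j
δ-swap k j c with j ℕ.≟ k
... | yes refl = ℤP.*-comm 1ℤ (c j)
... | no  _    = sym (ℤP.*-zeroʳ (c k))

unitSeq : ℕ → FinSeq
unitSeq k = finSeq (suc k) (δ k) (λ j k<j → δ-off-diagonal (λ j≡k → ℕP.<-irrefl (sym j≡k) k<j))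

truncated : ℕ → ℤ → ℕ → ℤ
truncated n z j with j <? n
... | yes _ = z
... | no  _ = 0ℤ

constSeq : ℕ → ℤ → FinSeq
constSeq n z = finSeq n (truncated n z) beyond
  where
  beyond : ∀ j → n ≤ j → truncated n z j ≡ 0ℤ
  beyond j n≤j with j <? n
  ... | yes j<n = ⊥-elim (ℕP.<⇒≱ j<n n≤j)
  ... | no  _   = refl

maxBound : ∀ {n} → (Fin n → FinSeq) → ℕ
maxBound {zero}  a = 0
maxBound {suc n} a = bound (a Fin.zero) ⊔ maxBound (λ i → a (Fin.suc i))

maxBound-≥ : ∀ {n} (a : Fin n → FinSeq) i → bound (a i) ≤ maxBound a
maxBound-≥ {suc n} a Fin.zero    = ℕP.m≤m⊔n _ _
maxBound-≥ {suc n} a (Fin.suc i) = ℕP.≤-trans (maxBound-≥ (λ i → a (Fin.suc i)) i) (ℕP.m≤n⊔m _ _)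

module DirectSum (m : ℕ → ℕ) where

  infix 4 _≈_
  record _≈_ (x y : FinSeq) : Set where
    constructor coordinatewise
    field at : ∀ j → coeff x j ≡ coeff y j mod m j
  open _≈_ public

  pointwise : ∀ {x y} → (∀ j → coeff x j ≡ coeff y j) → x ≈ y
  pointwise x≡y = coordinatewise λ j → mod-reflexive (x≡y j)

  group : Group 0ℓ 0ℓ
  group = record
    { Carrier = FinSeq
    ; _≈_ = _≈_
    ; _∙_ = _⊕_
    ; ε = zeroSeq
    ; _⁻¹ = ⊖_
    ; isGroup = record
      { isMonoid = record
        { isSemigroup = record
          { isMagma = record
            { isEquivalence = record
              { refl  = coordinatewise λ _ → mod-refl
              ; sym   = λ x≈y → coordinatewise λ j → mod-sym (at x≈y j)
              ; trans = λ x≈y y≈z → coordinatewise λ j → mod-trans (at x≈y j) (at y≈z j)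
              }
            ; ∙-cong = λ x≈y u≈v → coordinatewise λ j → mod-+ (at x≈y j) (at u≈v j)
            }
          ; assoc = λ x y z → pointwise λ j → ℤP.+-assoc (coeff x j) (coeff y j) (coeff z j)
          }
        ; identity = (λ x → pointwise λ j → ℤP.+-identityˡ (coeff x j))
                   , (λ x → pointwise λ j → ℤP.+-identityʳ (coeff x j))
        }
      ; inverse = (λ x → pointwise λ j → ℤP.+-inverseˡ (coeff x j))
                , (λ x → pointwise λ j → ℤP.+-inverseʳ (coeff x j))
      ; ⁻¹-cong = λ x≈y → coordinatewise λ j → mod-neg (at x≈y j)
      }
    }

  open Powers group public

  coeff-^⁺ : ∀ x n j → coeff (x ^⁺ n) j ≡ + n * coeff x j
  coeff-^⁺ x zero    j = sym (ℤP.*-zeroˡ (coeff x j))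
  coeff-^⁺ x (suc n) j = begin
    coeff x j + coeff (x ^⁺ n) j  ≡⟨ cong (λ c → coeff x j + c) (coeff-^⁺ x n j) ⟩
    coeff x j + + n * coeff x j   ≡⟨ lemma (+ n) (coeff x j) ⟩
    + suc n * coeff x j           ∎
    where
    open ≡-Reasoning
    lemma : ∀ n c → c + n * c ≡ (1ℤ + n) * c
    lemma = solve-∀

  coeff-^ : ∀ x z j → coeff (x ^ z) j ≡ z * coeff x j
  coeff-^ x (+ n)      j = coeff-^⁺ x n j
  coeff-^ x -[1+ n ] j = trans (cong -_ (coeff-^⁺ x (suc n) j)) (ℤP.neg-distribˡ-* (+ suc n) (coeff x j))

  scaleSeq : (ℕ → ℤ) → FinSeq → FinSeq
  scaleSeq c x = finSeq (bound x) (λ j → c j * coeff x j)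
                        (λ j le → trans (cong (c j *_) (vanishes x j le)) (ℤP.*-zeroʳ (c j)))

  scaling-automorphism : (c d : ℕ → ℤ) → (∀ j → c j * d j ≡ 1ℤ mod m j) → Automorphism group
  scaling-automorphism c d cd≡1 = record
    { α    = scaleSeq c
    ; cong = λ x y x≈y → coordinatewise λ j → mod-*ˡ (c j) (at x≈y j)
    ; hom  = λ x y → pointwise λ j → ℤP.*-distribˡ-+ (c j) (coeff x j) (coeff y j)
    ; inj  = λ x y cx≈cy → coordinatewise λ j → mod-cancel {c = c j} {d = d j} (cd≡1 j) (at cx≈cy j)
    ; surj = λ y → scaleSeq d y , coordinatewise (rescaled y)
    }
    where
    rescaled : ∀ y j → c j * (d j * coeff y j) ≡ coeff y j mod m j
    rescaled y j = begin
      c j * (d j * coeff y j)   ≡⟨ ℤP.*-assoc (c j) (d j) (coeff y j) ⟨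
      (c j * d j) * coeff y j   ≈⟨ mod-* (cd≡1 j) mod-refl ⟩
      1ℤ * coeff y j            ≡⟨ ℤP.*-identityˡ (coeff y j) ⟩
      coeff y j                 ∎
      where open ≡-mod-Reasoning (m j)

  δ-scale : ∀ {k c c'} → c ≡ c' mod m k → ∀ j → c * δ k j ≡ c' * δ k j mod m j
  δ-scale {k} {c} {c'} c≡c' j with j ℕ.≟ k
  ... | yes refl = mod-* c≡c' mod-refl
  ... | no  _    = mod-reflexive (trans (ℤP.*-zeroʳ c) (sym (ℤP.*-zeroʳ c')))

  unitSeq-^-cong : ∀ {k c c'} → c ≡ c' mod m k → unitSeq k ^ c ≈ unitSeq k ^ c'
  unitSeq-^-cong {k} {c} {c'} c≡c' = coordinatewise λ j →
    mod-trans (mod-reflexive (coeff-^ (unitSeq k) c j))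
              (mod-trans (δ-scale c≡c' j) (mod-reflexive (sym (coeff-^ (unitSeq k) c' j))))

  unitSeq-^-trivial : ∀ {k c} → c ≡ 0ℤ mod m k → unitSeq k ^ c ≈ zeroSeq
  unitSeq-^-trivial c≡0 = unitSeq-^-cong c≡0

  unitSeq-^-one : ∀ {k c} → c ≡ 1ℤ mod m k → unitSeq k ^ c ≈ unitSeq k
  unitSeq-^-one {k} c≡1 = Group.trans group (unitSeq-^-cong c≡1) (pointwise λ j → ℤP.+-identityʳ (δ k j))

  ^-^ : ∀ x c u → (x ^ c) ^ u ≈ x ^ (u * c)
  ^-^ x c u = pointwise λ j → begin
    coeff ((x ^ c) ^ u) j   ≡⟨ coeff-^ (x ^ c) u j ⟩
    u * coeff (x ^ c) j     ≡⟨ cong (u *_) (coeff-^ x c j) ⟩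
    u * (c * coeff x j)     ≡⟨ ℤP.*-assoc u c (coeff x j) ⟨
    (u * c) * coeff x j     ≡⟨ coeff-^ x (u * c) j ⟨
    coeff (x ^ (u * c)) j   ∎
    where open ≡-Reasoning

  coeff-unitSeq-^ : ∀ k c → coeff (unitSeq k ^ c) k ≡ c
  coeff-unitSeq-^ k c = trans (coeff-^ (unitSeq k) c k) (trans (cong (c *_) (δ-diagonal k)) (ℤP.*-identityʳ c))

  SupportedBelow : ℕ → FinSeq → Set
  SupportedBelow L x = ∀ j → L ≤ j → coeff x j ≡ 0ℤ mod m j

  eval-bound : ∀ {n} (a : Fin n → FinSeq) {L} → (∀ i → bound (a i) ≤ L) →
               ∀ w → bound (eval group a w) ≤ L
  eval-bound a a≤L (gen i) = a≤L i
  eval-bound a a≤L unit    = z≤n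
  eval-bound a a≤L (u · v) = ℕP.⊔-lub (eval-bound a a≤L u) (eval-bound a a≤L v)
  eval-bound a a≤L (inv u) = eval-bound a a≤L u

  generated-supported : ∀ {n} (a : Fin n → FinSeq) {L} → (∀ i → bound (a i) ≤ L) →
                        ∀ x → _∈⟨_⟩ group x a → SupportedBelow L x
  generated-supported a a≤L x (w , w↦x) j L≤j = begin
    coeff x j                 ≈⟨ at w↦x j ⟨
    coeff (eval group a w) j  ≡⟨ vanishes (eval group a w) j (ℕP.≤-trans (eval-bound a a≤L w) L≤j) ⟩
    0ℤ                        ∎
    where open ≡-mod-Reasoning (m j)

  module _ (m∣euclid : ∀ j → m j ∣ℕ euclid j) where

    projector : ℕ → ℕ → ℤ
    projector k L = proj₁ (chinese-remainder m∣euclid (δ k) (L ℕ.+ suc k))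

    projector-≡δ : ∀ k L j → j < L ⊎ j ≡ k → projector k L ≡ δ k j mod m j
    projector-≡δ k L j (inj₁ j<L) =
      proj₂ (chinese-remainder m∣euclid (δ k) (L ℕ.+ suc k)) j (ℕP.≤-trans j<L (ℕP.m≤m+n L (suc k)))
    projector-≡δ k L j (inj₂ refl) =
      proj₂ (chinese-remainder m∣euclid (δ k) (L ℕ.+ suc k)) j (ℕP.m≤n+m (suc k) L)

    projection : ∀ k L x → SupportedBelow L x → x ^ projector k L ≈ unitSeq k ^ coeff x k
    projection k L x x-supported = coordinatewise λ j →
      mod-trans (mod-reflexive (coeff-^ x E j))
                (mod-trans (coordinate j) (mod-reflexive (sym (coeff-^ (unitSeq k) (coeff x k) j))))
      where
      E : ℤ
      E = projector k L

      through-δ : ∀ {j} → j < L ⊎ j ≡ k → E * coeff x j ≡ coeff x k * δ k j mod m j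
      through-δ {j} j∈ = mod-trans (mod-* (projector-≡δ k L j j∈) mod-refl)
                                   (mod-reflexive (δ-swap k j (coeff x)))

      coordinate : ∀ j → E * coeff x j ≡ coeff x k * δ k j mod m j
      coordinate j with j <? L | toSum (j ℕ.≟ k)
      ... | yes j<L | _         = through-δ (inj₁ j<L)
      ... | no  _   | inj₁ j≡k  = through-δ (inj₂ j≡k)
      ... | no  j≮L | inj₂ j≢k  = begin
        E * coeff x j       ≈⟨ mod-*ˡ E (x-supported j (ℕP.≮⇒≥ j≮L)) ⟩
        E * 0ℤ              ≡⟨ ℤP.*-zeroʳ E ⟩
        0ℤ                  ≡⟨ ℤP.*-zeroʳ (coeff x k) ⟨
        coeff x k * 0ℤ      ≡⟨ cong (coeff x k *_) (δ-off-diagonal j≢k) ⟨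
        coeff x k * δ k j   ∎
        where open ≡-mod-Reasoning (m j)

    -- On the k-th summand ψ acts as multiplication by a unit c k modulo m k;
    -- the automorphism is then the rescaling of all coordinates by c.
    module Extension {n n′} (a : Fin n → FinSeq) (b : Fin n′ → FinSeq) (ψ : SubIso group a b) where
      open Generated group a using (generated; inclusion-isHom; subIso-isHom)
      private
        module A    = Group generated
        module Incl = HomProperties {generated} {group} inclusion-isHom
        module Ψ    = HomProperties {generated} {group} (subIso-isHom ψ)

        infixr 8 _^ᴬ_
        _^ᴬ_ : ⟨_⟩ group a → ℤ → ⟨_⟩ group a
        _^ᴬ_ = Powers._^_ generated

      φ : ⟨_⟩ group a → FinSeq
      φ h = proj₁ (SubIso.φ ψ h)

      L : ℕ
      L = maxBound a ⊔ maxBound b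

      a-supported : ∀ h → SupportedBelow L (proj₁ h)
      a-supported (x , x∈⟨a⟩) = generated-supported a
        (λ i → ℕP.≤-trans (maxBound-≥ a i) (ℕP.m≤m⊔n _ _)) x x∈⟨a⟩

      b-supported : ∀ h → SupportedBelow L (φ h)
      b-supported h = generated-supported b
        (λ i → ℕP.≤-trans (maxBound-≥ b i) (ℕP.m≤n⊔m _ _)) (φ h) (proj₂ (SubIso.φ ψ h))

      E : ℕ → ℤ
      E k = projector k L

      projected : ∀ k h → proj₁ (h ^ᴬ E k) ≈ unitSeq k ^ coeff (proj₁ h) k
      projected k h = Group.trans group (Incl.^-homo h (E k)) (projection k L (proj₁ h) (a-supported h))

      φ-projected : ∀ k h → coeff (φ h) k ≡ coeff (φ (h ^ᴬ E k)) k mod m k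
      φ-projected k h = begin
        coeff (φ h) k                                ≡⟨ coeff-unitSeq-^ k (coeff (φ h) k) ⟨
        coeff (unitSeq k ^ coeff (φ h) k) k          ≈⟨ at (projection k L (φ h) (b-supported h)) k ⟨
        coeff (φ h ^ E k) k                          ≈⟨ at (Ψ.^-homo h (E k)) k ⟨
        coeff (φ (h ^ᴬ E k)) k                       ∎
        where open ≡-mod-Reasoning (m k)

      record Multiplier (k : ℕ) : Set where
        field
          factor     : ℤ
          inverse    : ℤ
          invertible : factor * inverse ≡ 1ℤ mod m k
          scales     : ∀ h → coeff (φ h) k ≡ factor * coeff (proj₁ h) k mod m k

      -- Case 1: all generators, hence all of ⟨a⟩ and its image, vanish at k.
      trivial-multiplier : ∀ k → (∀ i → + m k ∣ coeff (a i) k) → Multiplier k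
      trivial-multiplier k a-vanishes = record
        { factor = 1ℤ ; inverse = 1ℤ ; invertible = mod-refl ; scales = scales }
        where
        word-vanishes : ∀ w → coeff (eval group a w) k ≡ 0ℤ mod m k
        word-vanishes (gen i) = ∣⇒≡0 (a-vanishes i)
        word-vanishes unit    = mod-refl
        word-vanishes (u · v) = mod-+ (word-vanishes u) (word-vanishes v)
        word-vanishes (inv u) = mod-neg (word-vanishes u)

        vanishes-at-k : ∀ h → coeff (proj₁ h) k ≡ 0ℤ mod m k
        vanishes-at-k (x , w , w↦x) = mod-trans (mod-sym (at w↦x k)) (word-vanishes w)

        image-trivial : ∀ h → φ (h ^ᴬ E k) ≈ zeroSeq
        image-trivial h = Group.trans group
          (SubIso.cong ψ (h ^ᴬ E k) A.ε
            (Group.trans group (projected k h) (unitSeq-^-trivial (vanishes-at-k h))))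
          Ψ.ε-homo

        scales : ∀ h → coeff (φ h) k ≡ 1ℤ * coeff (proj₁ h) k mod m k
        scales h = begin
          coeff (φ h) k                ≈⟨ φ-projected k h ⟩
          coeff (φ (h ^ᴬ E k)) k       ≈⟨ at (image-trivial h) k ⟩
          0ℤ                           ≈⟨ vanishes-at-k h ⟨
          coeff (proj₁ h) k            ≡⟨ ℤP.*-identityˡ (coeff (proj₁ h) k) ⟨
          1ℤ * coeff (proj₁ h) k       ∎
          where open ≡-mod-Reasoning (m k)

      -- Case 2: ⟨a⟩ contains an element e equal to e k.  Then ψ acts at k as
      -- multiplication by c = ψ(e)_k, and c is a unit unless m k = 1, because
      -- ψ is injective and ψ(e) is the power e k ^ c.
      module _ (k : ℕ) (e : ⟨_⟩ group a) (e≈unit : proj₁ e ≈ unitSeq k) where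
        private
          c : ℤ
          c = coeff (φ e) k

        scales-like-image : ∀ h → coeff (φ h) k ≡ c * coeff (proj₁ h) k mod m k
        scales-like-image h = begin
          coeff (φ h) k                          ≈⟨ φ-projected k h ⟩
          coeff (φ (h ^ᴬ E k)) k                 ≈⟨ at (SubIso.cong ψ (h ^ᴬ E k) (e ^ᴬ t) h^E≈e^t) k ⟩
          coeff (φ (e ^ᴬ t)) k                   ≈⟨ at (Ψ.^-homo e t) k ⟩
          coeff (φ e ^ t) k                      ≡⟨ coeff-^ (φ e) t k ⟩
          t * c                                  ≡⟨ ℤP.*-comm t c ⟩
          c * t                                  ∎
          where
          open ≡-mod-Reasoning (m k)
          t : ℤ
          t = coeff (proj₁ h) k
          h^E≈e^t : proj₁ (h ^ᴬ E k) ≈ proj₁ (e ^ᴬ t)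
          h^E≈e^t = Group.trans group (projected k h) (Group.trans group
                      (^-cong (Group.sym group e≈unit) t) (Group.sym group (Incl.^-homo e t)))

        image-unit : + m k ∣ c → + m k ∣ 1ℤ
        image-unit mk∣c = ≡0⇒∣ (mod-trans (mod-reflexive (sym (δ-diagonal k))) (at unit≈ε k))
          where
          open Relation.Binary.Reasoning.Setoid (Group.setoid group)
          e≈e^E : proj₁ e ≈ proj₁ (e ^ᴬ E k)
          e≈e^E = begin
            proj₁ e                          ≈⟨ e≈unit ⟩
            unitSeq k                        ≈⟨ unitSeq-^-one (mod-trans (at e≈unit k) (mod-reflexive (δ-diagonal k))) ⟨
            unitSeq k ^ coeff (proj₁ e) k    ≈⟨ projected k e ⟨
            proj₁ (e ^ᴬ E k)                 ∎

          φe≈ε : φ e ≈ zeroSeq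
          φe≈ε = begin
            φ e               ≈⟨ SubIso.cong ψ e (e ^ᴬ E k) e≈e^E ⟩
            φ (e ^ᴬ E k)      ≈⟨ Ψ.^-homo e (E k) ⟩
            φ e ^ E k         ≈⟨ projection k L (φ e) (b-supported e) ⟩
            unitSeq k ^ c     ≈⟨ unitSeq-^-trivial (∣⇒≡0 mk∣c) ⟩
            zeroSeq           ∎

          unit≈ε : unitSeq k ≈ zeroSeq
          unit≈ε = Group.trans group (Group.sym group e≈unit) (Ψ.injective-reflects-ε (SubIso.inj ψ) e φe≈ε)

      -- A generator aᵢ which is a unit at k yields e k ∈ ⟨a⟩ as (aᵢ ^ E) ^ u,
      -- where u is the inverse of its k-th coordinate.
      unit-from-generator : ∀ k i → ¬ (+ m k ∣ coeff (a i) k) → Σ (⟨_⟩ group a) λ e → proj₁ e ≈ unitSeq k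
      unit-from-generator k i aᵢ-unit = (aᵢ ^ᴬ E k) ^ᴬ u , (begin
        proj₁ ((aᵢ ^ᴬ E k) ^ᴬ u)             ≈⟨ Incl.^-homo (aᵢ ^ᴬ E k) u ⟩
        proj₁ (aᵢ ^ᴬ E k) ^ u                ≈⟨ ^-cong (projected k aᵢ) u ⟩
        (unitSeq k ^ coeff (a i) k) ^ u      ≈⟨ ^-^ (unitSeq k) (coeff (a i) k) u ⟩
        unitSeq k ^ (u * coeff (a i) k)      ≈⟨ unitSeq-^-one u·aᵢ≡1 ⟩
        unitSeq k                            ∎)
        where
        open Relation.Binary.Reasoning.Setoid (Group.setoid group)
        aᵢ : ⟨_⟩ group a
        aᵢ = a i , gen i , Group.refl group
        u : ℤ
        u = proj₁ (inverse-mod m∣euclid k (coeff (a i) k) aᵢ-unit)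
        u·aᵢ≡1 : u * coeff (a i) k ≡ 1ℤ mod m k
        u·aᵢ≡1 = proj₂ (inverse-mod m∣euclid k (coeff (a i) k) aᵢ-unit)

      unit-multiplier : ∀ k i → ¬ (+ m k ∣ coeff (a i) k) → Multiplier k
      unit-multiplier k i aᵢ-unit = record
        { factor = c ; inverse = d ; invertible = cd≡1 ; scales = scales-like-image k e e≈unit }
        where
        e : ⟨_⟩ group a
        e = proj₁ (unit-from-generator k i aᵢ-unit)
        e≈unit : proj₁ e ≈ unitSeq k
        e≈unit = proj₂ (unit-from-generator k i aᵢ-unit)
        c : ℤ
        c = coeff (φ e) k

        c-unit : ¬ (+ m k ∣ c)
        c-unit mk∣c = aᵢ-unit (subst (+ m k ∣_) (ℤP.*-identityʳ (coeff (a i) k))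
                                  (∣n⇒∣m*n (coeff (a i) k) (image-unit k e e≈unit mk∣c)))

        d : ℤ
        d = proj₁ (inverse-mod m∣euclid k c c-unit)
        cd≡1 : c * d ≡ 1ℤ mod m k
        cd≡1 = mod-trans (mod-reflexive (ℤP.*-comm c d)) (proj₂ (inverse-mod m∣euclid k c c-unit))

      multiplier : ∀ k → Multiplier k
      multiplier k with all? (λ i → + m k ∣? coeff (a i) k)
      ... | yes all-vanish = trivial-multiplier k all-vanish
      ... | no  not-all    with ¬∀⟶∃¬ n _ (λ i → + m k ∣? coeff (a i) k) not-all
      ...   | i , aᵢ-unit  = unit-multiplier k i aᵢ-unit

      open Multiplier

      extension : Automorphism group
      extension = scaling-automorphism (λ k → factor (multiplier k)) (λ k → inverse (multiplier k))
                                       (λ k → invertible (multiplier k))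

      extends : ∀ h → Automorphism.α extension (proj₁ h) ≈ φ h
      extends h = coordinatewise λ k → mod-sym (scales (multiplier k) h)

    homogeneous : Homogeneous group
    homogeneous a b ψ = Extension.extension a b ψ , Extension.extends a b ψ

    -- By the Chinese remainder theorem every element equals a constant
    -- sequence, so enumerating ℕ × ℤ enumerates the group.
    constant-representative : ∀ x → ∃ λ z → constSeq (bound x) z ≈ x
    constant-representative x with chinese-remainder m∣euclid (coeff x) (bound x)
    ... | z , z≡x = z , coordinatewise coordinate
      where
      coordinate : ∀ j → truncated (bound x) z j ≡ coeff x j mod m j
      coordinate j with j <? bound x
      ... | yes j<n = z≡x j j<n
      ... | no  j≮n = mod-reflexive (sym (vanishes x j (ℕP.≮⇒≥ j≮n)))

    countable : Countable group
    countable = (λ N → constSeq (proj₁ (enumerate N)) (proj₂ (enumerate N))) , enumerated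
      where
      enumerated : ∀ x → ∃ λ N → constSeq (proj₁ (enumerate N)) (proj₂ (enumerate N)) ≈ x
      enumerated x with constant-representative x
      ... | z , const≈x with enumerate-surjective (bound x) z
      ...   | N , enumerate-N = N , subst (λ p → constSeq (proj₁ p) (proj₂ p) ≈ x) (sym enumerate-N) const≈x

    torsion-present : ∀ k → m k ≡ euclid k → HasTorsion (euclid k)
    torsion-present k mk≡e = unitSeq k , unit≉ε , unitSeq-^-trivial {c = + euclid k} (∣⇒≡0 (∣ᵤ⇒∣ (m∣euclid k)))
      where
      unit≉ε : ¬ (unitSeq k ≈ zeroSeq)
      unit≉ε unit≈ε = ¬prime[1] (subst Prime e≡1 (euclid-prime k))
        where
        1≡0 : 1ℤ ≡ 0ℤ mod m k
        1≡0 = mod-trans (mod-reflexive (sym (δ-diagonal k))) (at unit≈ε k)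
        e≡1 : euclid k ≡ 1
        e≡1 = trans (sym mk≡e) (ℕ∣.∣1⇒≡1 (∣⇒∣ᵤ (≡0⇒∣ 1≡0)))

    torsion-absent : ∀ k → m k ≡ 1 → ¬ HasTorsion (euclid k)
    torsion-absent k mk≡1 (x , x≉ε , xᵖ≈ε) = x≉ε (coordinatewise coordinate)
      where
      coordinate : ∀ j → coeff x j ≡ 0ℤ mod m j
      coordinate j with toSum (j ℕ.≟ k)
      ... | inj₁ refl rewrite mk≡1 = mod-one
      ... | inj₂ j≢k  = euclid-cancel m∣euclid j≢k
                          (mod-trans (mod-reflexive (sym (coeff-^ x (+ euclid k) j))) (at xᵖ≈ε j))

modulus : (ℕ → Bool) → ℕ → ℕ
modulus s k = if s k then euclid k else 1

modulus-∣-euclid : ∀ s k → modulus s k ∣ℕ euclid k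
modulus-∣-euclid s k with s k
... | true  = ℕ∣.∣-refl
... | false = ℕ∣.1∣ euclid k

family : (ℕ → Bool) → Group 0ℓ 0ℓ
family s = DirectSum.group (modulus s)

modulus-at : ∀ s k {b} → s k ≡ b → modulus s k ≡ (if b then euclid k else 1)
modulus-at s k = cong (λ b → if b then euclid k else 1)

torsion-detects : ∀ s k → Powers.HasTorsion (family s) (euclid k) ⇔ (s k ≡ true)
torsion-detects s k with s k in sk
... | true  = mk⇔ (λ _ → refl) (λ _ → torsion-present (modulus-∣-euclid s) k (modulus-at s k sk))
  where open DirectSum (modulus s)
... | false = mk⇔ (λ torsion → ⊥-elim (torsion-absent (modulus-∣-euclid s) k (modulus-at s k sk) torsion))
                  λ ()
  where open DirectSum (modulus s)

family-injective : ∀ s t → family s ≅ family t → ∀ k → s k ≡ t k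
family-injective s t I k = ⇔→≡ (mk⇔
  (λ sk → to (torsion-detects t k) (≅-preserves-torsion I (euclid k) (from (torsion-detects s k) sk)))
  (λ tk → to (torsion-detects s k) (≅-reflects-torsion I (euclid k) (from (torsion-detects t k) tk))))
  where open Equivalence

corollary2p7 : Σ ((ℕ → Bool) → Group 0ℓ 0ℓ) λ F →
    (∀ s → Countable (F s) × Homogeneous (F s)) ×
    (∀ s t → ¬ (∀ k → s k ≡ t k) → ¬ (F s ≅ F t))
corollary2p7 = family , countable-homogeneous , distinct
  where
  countable-homogeneous : ∀ s → Countable (family s) × Homogeneous (family s)
  countable-homogeneous s = DirectSum.countable (modulus s) (modulus-∣-euclid s)
                          , DirectSum.homogeneous (modulus s) (modulus-∣-euclid s)
  distinct : ∀ s t → ¬ (∀ k → s k ≡ t k) → ¬ (family s ≅ family t)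
  distinct s t s≢t I = s≢t (family-injective s t I)
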